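{- Let $v,w\in S_n$. Then $w$ covers $v$ in the middle order $\mathcal{P}_n$ if and only if there are positions $a<b$ with $v(a)<v(b)$ such that no position $c$ with $a<c<b$ satisfies $v(c)<v(b)$, and $w$ is obtained from $v$ by swapping the entries in positions $a$ and $b$. (Equivalently: $v$ and $w$ differ exactly by an occurrence in $v$ of the mesh pattern with underlying pattern $12$ and shaded region consisting of the points strictly between the two pattern entries horizontally and below the larger entry, becoming an occurrence in $w$ of the mesh pattern with underlying pattern $21$ with the same shaded region.)
   Context: Permutations are written in one-line notation $w=w(1)\cdots w(n)$. For $w\in S_n$, its inversion sequence is $I(w)=(x_1,\ldots,x_n)$ with $x_i=\#\{j<i : w^{ -1}(j)>w^{ -1}(i)\}$. The middle order $\mathcal{P}_n$ is the poset on $S_n$ with $v\le w$ if and only if $I(v)\le I(w)$ coordinate-wise. A mesh pattern $(p,M)$ with $p\in S_k$ and $M$ a set of unit squares of $[0,k+1]^2$ is contained in $w$ if there is an occurrence of $p$ in $w$ such that the regions of the plot of $w$ corresponding to the shaded squares contain no points of the plot $\{(i,w(i))\}$. -}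

module Defs where

open import Data.Nat using (ℕ; _≤_)
open import Data.Fin using (Fin; _<_; _>_; _<?_)
open import Data.Fin.Permutation public using (Permutation′; _⟨$⟩ʳ_; _⟨$⟩ˡ_)
open import Data.List using (List; length; filter; allFin)
open import Data.Product using (_×_; ∃-syntax)
open import Relation.Nullary using (¬_)
open import Relation.Nullary.Decidable using (_×-dec_)
open import Relation.Binary.PropositionalEquality using (_≡_)

-- A permutation w ∈ S_n is a bijection Fin n ↔ Fin n (positions and values
-- 0-indexed); w ⟨$⟩ʳ i = w(i), w ⟨$⟩ˡ j = w⁻¹(j).

invSeq : ∀ {n} → Permutation′ n → Fin n → ℕ
invSeq {n} w i =
  length (filter (λ j → (j <? i) ×-dec ((w ⟨$⟩ˡ i) <? (w ⟨$⟩ˡ j))) (allFin n))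

_≤ₘ_ : ∀ {n} → Permutation′ n → Permutation′ n → Set
v ≤ₘ w = ∀ i → invSeq v i ≤ invSeq w i

_≈ₚ_ : ∀ {n} → Permutation′ n → Permutation′ n → Set
v ≈ₚ w = ∀ i → v ⟨$⟩ʳ i ≡ w ⟨$⟩ʳ i

_<ₘ_ : ∀ {n} → Permutation′ n → Permutation′ n → Set
v <ₘ w = v ≤ₘ w × ¬ (v ≈ₚ w)

Covers : ∀ {n} → Permutation′ n → Permutation′ n → Set
Covers {n} v w = v <ₘ w × ¬ (∃[ u ] (v <ₘ u × u <ₘ w))

SwapOf : ∀ {n} → Permutation′ n → Permutation′ n → Fin n → Fin n → Set
SwapOf v w a b =
  (w ⟨$⟩ʳ a ≡ v ⟨$⟩ʳ b) × (w ⟨$⟩ʳ b ≡ v ⟨$⟩ʳ a) ×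
  (∀ c → ¬ (c ≡ a) → ¬ (c ≡ b) → w ⟨$⟩ʳ c ≡ v ⟨$⟩ʳ c)

-- Swapping the entries of a mesh occurrence a < b of v raises its inversion sequence by
-- exactly one, at the value B = v(b): A = v(a) is the only smaller value changing sides
-- with respect to B, and each value placed strictly between positions a and b exceeds B,
-- so it gains A and loses B as an inversion. A permutation is determined by its inversion
-- sequence, so nothing lies strictly between v and the swap. Conversely, if w covers v
-- then I(v) < I(w) at some value k; as then x_k < k in v, a smaller value precedes k, and
-- the nearest such position a yields a mesh occurrence (a, v⁻¹(k)) whose swap u satisfies
-- v < u ≤ w, hence u = w.
module Submission where

open import Defs
open import Data.Fin using (Fin; zero; suc; toℕ; inject₁; _<_; _≤_; _>_; _≟_; _<?_)
open import Data.Fin.Induction using (<-wellFounded; >-wellFounded; <-weakInduction)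
open import Data.Fin.Permutation using (inverseˡ; inverseʳ; transpose; _∘ₚ_)
import Data.Fin.Permutation.Components as Components
import Data.Fin.Properties as FinP
open import Data.List using (length; filter; tabulate)
open import Data.Nat as ℕ using (ℕ; zero; suc; _+_; z≤n)
import Data.Nat.Properties as ℕP
open import Algebra.Properties.CommutativeSemigroup ℕP.+-commutativeSemigroup using (x∙yz≈y∙xz)
open import Data.Product as Product using (_×_; _,_; proj₁; proj₂; ∃-syntax; swap)
open import Data.Empty using (⊥; ⊥-elim)
open import Data.Sum as Sum using (_⊎_)
open import Function using (_∘_; id)
open import Function.Bundles using (_⇔_; mk⇔; Equivalence)
open import Induction.WellFounded using (Acc; acc)
open import Level using (0ℓ)
open import Relation.Binary.Definitions using (tri<; tri≈; tri>)
open import Relation.Binary.PropositionalEquality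
open import Relation.Nullary using (¬_; Dec; yes; no; contradiction)
open import Relation.Nullary.Decidable using (_×-dec_; ¬?; decidable-stable)
open import Relation.Unary using (Pred; Decidable; _⊆′_; _≐′_)

open Equivalence using (to; from)

private
  variable
    n : ℕ
    u v w : Permutation′ n
    a b i j k x y : Fin n

≢∧≮⇒> : x ≢ y → ¬ x < y → y < x
≢∧≮⇒> x≢y x≮y = FinP.≤∧≢⇒< (ℕP.≮⇒≥ x≮y) (x≢y ∘ sym)

indicator : {P : Set} → Dec P → ℕ
indicator (yes _) = 1
indicator (no _)  = 0

indicator-yes : {P : Set} (p? : Dec P) → P → indicator p? ≡ 1
indicator-yes (yes _) _  = refl
indicator-yes (no ¬p) p = contradiction p ¬p

indicator-no : {P : Set} (p? : Dec P) → ¬ P → indicator p? ≡ 0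
indicator-no (yes p) ¬p = contradiction p ¬p
indicator-no (no _)  _  = refl

indicator-cong : {P Q : Set} (p? : Dec P) (q? : Dec Q) → P ⇔ Q → indicator p? ≡ indicator q?
indicator-cong (yes _) (yes _) _   = refl
indicator-cong (yes p) (no ¬q) P⇔Q = contradiction (to P⇔Q p) ¬q
indicator-cong (no ¬p) (yes q) P⇔Q = contradiction (from P⇔Q q) ¬p
indicator-cong (no _)  (no _)  _   = refl

indicator-mono : {P Q : Set} (p? : Dec P) (q? : Dec Q) →
                 (P → Q) → indicator p? ℕ.≤ indicator q?
indicator-mono (yes _) (yes _) _   = ℕP.≤-refl
indicator-mono (yes p) (no ¬q) P⇒Q = contradiction (P⇒Q p) ¬q
indicator-mono (no _)  _       _   = z≤n

count : {P : Pred (Fin n) 0ℓ} → Decidable P → ℕ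
count {zero}  P? = 0
count {suc n} P? = indicator (P? zero) + count (P? ∘ suc)

length-filter-tabulate : {A : Set} {P : Pred A 0ℓ} (P? : Decidable P) (f : Fin n → A) →
                         length (filter P? (tabulate f)) ≡ count (P? ∘ f)
length-filter-tabulate {zero}  P? f = refl
length-filter-tabulate {suc n} P? f with P? (f zero)
... | yes _ = cong suc (length-filter-tabulate P? (f ∘ suc))
... | no _  = length-filter-tabulate P? (f ∘ suc)

count-cong : {P Q : Pred (Fin n) 0ℓ} (P? : Decidable P) (Q? : Decidable Q) →
             (∀ j → P j ⇔ Q j) → count P? ≡ count Q?
count-cong {zero}  _  _  _   = refl
count-cong {suc n} P? Q? P⇔Q = cong₂ _+_ (indicator-cong (P? zero) (Q? zero) (P⇔Q zero))
                                         (count-cong (P? ∘ suc) (Q? ∘ suc) (P⇔Q ∘ suc))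

count-mono : {P Q : Pred (Fin n) 0ℓ} (P? : Decidable P) (Q? : Decidable Q) →
             P ⊆′ Q → count P? ℕ.≤ count Q?
count-mono {zero}  _  _  _   = z≤n
count-mono {suc n} P? Q? P⊆Q = ℕP.+-mono-≤ (indicator-mono (P? zero) (Q? zero) (P⊆Q zero))
                                          (count-mono (P? ∘ suc) (Q? ∘ suc) (P⊆Q ∘ suc))

count-none : {P : Pred (Fin n) 0ℓ} (P? : Decidable P) → (∀ j → ¬ P j) → count P? ≡ 0
count-none {zero}  _  _    = refl
count-none {suc n} P? none = cong₂ _+_ (indicator-no (P? zero) (none zero))
                                       (count-none (P? ∘ suc) (none ∘ suc))

count-< : (k : Fin n) → count {n} (_<? k) ≡ toℕ k
count-< {suc n} zero    = count-none (λ (j : Fin (suc n)) → j <? zero {n}) (λ _ ())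
count-< {suc n} (suc k) = cong₂ _+_ (indicator-yes (zero {n} <? suc k) ℕ.z<s)
  (trans (count-cong {n} (λ j → suc j <? suc k) (_<? k) (λ _ → mk⇔ ℕ.s<s⁻¹ ℕ.s<s))
         (count-< k))

_∖?_ : {P : Pred (Fin n) 0ℓ} → Decidable P → (x : Fin n) → Decidable (λ j → P j × j ≢ x)
(P? ∖? x) j = P? j ×-dec ¬? (j ≟ x)

count-split : {P : Pred (Fin n) 0ℓ} (P? : Decidable P) (x : Fin n) →
              count P? ≡ indicator (P? x) + count (P? ∖? x)
count-split {suc n} P? zero = cong (indicator (P? zero) +_) (begin
  count (P? ∘ suc)
    ≡⟨ count-cong (P? ∘ suc) ((P? ∖? zero) ∘ suc) (λ _ → mk⇔ (_, λ ()) proj₁) ⟩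
  count ((P? ∖? zero) ∘ suc)
    ≡⟨ cong (_+ count ((P? ∖? zero) ∘ suc)) (indicator-no ((P? ∖? zero) zero) (λ (_ , 0≢0) → 0≢0 refl)) ⟨
  indicator ((P? ∖? zero) zero) + count ((P? ∖? zero) ∘ suc) ∎)
  where open ≡-Reasoning
count-split {suc n} P? (suc x) = begin
  indicator (P? zero) + count (P? ∘ suc)
    ≡⟨ cong (indicator (P? zero) +_) (count-split (P? ∘ suc) x) ⟩
  indicator (P? zero) + (indicator (P? (suc x)) + count ((P? ∘ suc) ∖? x))
    ≡⟨ x∙yz≈y∙xz (indicator (P? zero)) _ (count ((P? ∘ suc) ∖? x)) ⟩
  indicator (P? (suc x)) + (indicator (P? zero) + count ((P? ∘ suc) ∖? x))
    ≡⟨ cong (indicator (P? (suc x)) +_) (cong₂ _+_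
         (indicator-cong (P? zero) ((P? ∖? suc x) zero) (mk⇔ (_, λ ()) proj₁))
         (count-cong ((P? ∘ suc) ∖? x) ((P? ∖? suc x) ∘ suc)
           (λ _ → mk⇔ (λ (p , j≢x) → p , j≢x ∘ FinP.suc-injective)
                      (λ (p , sj≢sx) → p , sj≢sx ∘ cong suc)))) ⟩
  indicator (P? (suc x)) + count (P? ∖? suc x) ∎
  where open ≡-Reasoning

count-mono-< : {P Q : Pred (Fin n) 0ℓ} (P? : Decidable P) (Q? : Decidable Q) →
               P ⊆′ Q → ¬ P x → Q x → count P? ℕ.< count Q?
count-mono-< {x = x} P? Q? P⊆Q ¬Px Qx = begin-strict
  count P?                           ≡⟨ count-split P? x ⟩
  indicator (P? x) + count (P? ∖? x) ≡⟨ cong (_+ count (P? ∖? x)) (indicator-no (P? x) ¬Px) ⟩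
  count (P? ∖? x)                    ≤⟨ count-mono (P? ∖? x) (Q? ∖? x) (λ j → Product.map₁ (P⊆Q j)) ⟩
  count (Q? ∖? x)                    <⟨ ℕP.n<1+n _ ⟩
  1 + count (Q? ∖? x)                ≡⟨ cong (_+ count (Q? ∖? x)) (indicator-yes (Q? x) Qx) ⟨
  indicator (Q? x) + count (Q? ∖? x) ≡⟨ count-split Q? x ⟨
  count Q?                           ∎
  where open ℕP.≤-Reasoning

×-≢-cong : {P Q : Set} → (j ≢ x → P ⇔ Q) → (P × j ≢ x) ⇔ (Q × j ≢ x)
×-≢-cong P⇔Q = mk⇔ (λ (p , j≢x) → to (P⇔Q j≢x) p , j≢x) (λ (q , j≢x) → from (P⇔Q j≢x) q , j≢x)

count-∖-cong : {P Q : Pred (Fin n) 0ℓ} (P? : Decidable P) (Q? : Decidable Q) (x : Fin n) →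
               (∀ j → j ≢ x → P j ⇔ Q j) → count (P? ∖? x) ≡ count (Q? ∖? x)
count-∖-cong P? Q? x agree = count-cong (P? ∖? x) (Q? ∖? x) (λ j → ×-≢-cong (agree j))

count-insert : {P Q : Pred (Fin n) 0ℓ} (P? : Decidable P) (Q? : Decidable Q) (x : Fin n) →
               (∀ j → j ≢ x → P j ⇔ Q j) → ¬ P x → Q x → count Q? ≡ suc (count P?)
count-insert P? Q? x agree ¬Px Qx = begin
  count Q?
    ≡⟨ count-split Q? x ⟩
  indicator (Q? x) + count (Q? ∖? x)
    ≡⟨ cong₂ _+_ (indicator-yes (Q? x) Qx) (sym (count-∖-cong P? Q? x agree)) ⟩
  1 + count (P? ∖? x)
    ≡⟨ cong (λ k → suc (k + count (P? ∖? x))) (indicator-no (P? x) ¬Px) ⟨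
  suc (indicator (P? x) + count (P? ∖? x))
    ≡⟨ cong suc (count-split P? x) ⟨
  suc (count P?) ∎
  where open ≡-Reasoning

count-split₂ : {P : Pred (Fin n) 0ℓ} (P? : Decidable P) → x ≢ y →
               count P? ≡ indicator (P? x) + (indicator (P? y) + count ((P? ∖? x) ∖? y))
count-split₂ {x = x} {y} P? x≢y =
  trans (count-split P? x) (cong (indicator (P? x) +_)
    (trans (count-split (P? ∖? x) y)
           (cong (_+ count ((P? ∖? x) ∖? y))
                 (indicator-cong ((P? ∖? x) y) (P? y) (mk⇔ proj₁ (_, x≢y ∘ sym))))))

count-swap : {P Q : Pred (Fin n) 0ℓ} (P? : Decidable P) (Q? : Decidable Q) → x ≢ y →
             (∀ j → j ≢ x → j ≢ y → P j ⇔ Q j) → P x ⇔ Q y → P y ⇔ Q x →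
             count P? ≡ count Q?
count-swap {x = x} {y} P? Q? x≢y agree Px⇔Qy Py⇔Qx = begin
  count P?
    ≡⟨ count-split₂ P? x≢y ⟩
  indicator (P? x) + (indicator (P? y) + count ((P? ∖? x) ∖? y))
    ≡⟨ cong₂ _+_ (indicator-cong (P? x) (Q? y) Px⇔Qy) (cong₂ _+_ (indicator-cong (P? y) (Q? x) Py⇔Qx)
         (count-∖-cong (P? ∖? x) (Q? ∖? x) y λ j j≢y → ×-≢-cong (λ j≢x → agree j j≢x j≢y))) ⟩
  indicator (Q? y) + (indicator (Q? x) + count ((Q? ∖? x) ∖? y))
    ≡⟨ x∙yz≈y∙xz (indicator (Q? y)) (indicator (Q? x)) (count ((Q? ∖? x) ∖? y)) ⟩
  indicator (Q? x) + (indicator (Q? y) + count ((Q? ∖? x) ∖? y))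
    ≡⟨ count-split₂ Q? x≢y ⟨
  count Q? ∎
  where open ≡-Reasoning

count-≡⇒⊆ : {P Q : Pred (Fin n) 0ℓ} (P? : Decidable P) (Q? : Decidable Q) →
            count P? ≡ count Q? →
            (∀ {j j′} → P j → ¬ Q j → Q j′ → ¬ P j′ → ⊥) → P ⊆′ Q
count-≡⇒⊆ {P = P} {Q} P? Q? eq crossing j Pj with Q? j
... | yes Qj  = Qj
... | no  ¬Qj = contradiction (sym eq) (ℕP.<⇒≢ (count-mono-< Q? P? Q⊆P ¬Qj Pj))
  where
  Q⊆P : Q ⊆′ P
  Q⊆P j′ Qj′ with P? j′
  ... | yes Pj′ = Pj′
  ... | no ¬Pj′ = ⊥-elim (crossing Pj ¬Qj Qj′ ¬Pj′)

Before : Permutation′ n → Fin n → Fin n → Set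
Before w x y = w ⟨$⟩ˡ x < w ⟨$⟩ˡ y

⟨$⟩ʳ-injective : (w : Permutation′ n) → w ⟨$⟩ʳ x ≡ w ⟨$⟩ʳ y → x ≡ y
⟨$⟩ʳ-injective w eq = trans (sym (inverseˡ w)) (trans (cong (w ⟨$⟩ˡ_) eq) (inverseˡ w))

⟨$⟩ˡ-injective : (w : Permutation′ n) → w ⟨$⟩ˡ x ≡ w ⟨$⟩ˡ y → x ≡ y
⟨$⟩ˡ-injective w eq = trans (sym (inverseʳ w)) (trans (cong (w ⟨$⟩ʳ_) eq) (inverseʳ w))

Before-total : (w : Permutation′ n) → x ≢ y → ¬ Before w x y → Before w y x
Before-total w x≢y = ≢∧≮⇒> (x≢y ∘ ⟨$⟩ˡ-injective w)

⟨$⟩ˡ-≢ : (w : Permutation′ n) → x ≢ w ⟨$⟩ʳ a → w ⟨$⟩ˡ x ≢ a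
⟨$⟩ˡ-≢ w x≢wa p≡a = x≢wa (trans (sym (inverseʳ w)) (cong (w ⟨$⟩ʳ_) p≡a))

Inversion : Permutation′ n → Fin n → Pred (Fin n) 0ℓ
Inversion w i j = j < i × Before w i j

inversion? : (w : Permutation′ n) (i : Fin n) → Decidable (Inversion w i)
inversion? w i j = (j <? i) ×-dec (w ⟨$⟩ˡ i <? w ⟨$⟩ˡ j)

inversion-cong : (u v : Permutation′ n) →
                 (j < i → Before u i j ⇔ Before v i j) → Inversion u i j ⇔ Inversion v i j
inversion-cong u v B⇔B = mk⇔ (λ (j<i , b) → j<i , to (B⇔B j<i) b) (λ (j<i , b) → j<i , from (B⇔B j<i) b)

noninversion : (w : Permutation′ n) → j < i → ¬ Inversion w i j → Before w j i
noninversion w j<i ¬inv = Before-total w (FinP.<⇒≢ j<i ∘ sym) (¬inv ∘ (j<i ,_))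

inversion-out-of-range : (u v : Permutation′ n) → ¬ j < i → Inversion u i j ⇔ Inversion v i j
inversion-out-of-range u v j≮i =
  mk⇔ (λ (j<i , _) → contradiction j<i j≮i) (λ (j<i , _) → contradiction j<i j≮i)

invSeq-count : (w : Permutation′ n) (i : Fin n) → invSeq w i ≡ count (inversion? w i)
invSeq-count w i = length-filter-tabulate (inversion? w i) id

invSeq-≤ : (w : Permutation′ n) (i : Fin n) → invSeq w i ℕ.≤ toℕ i
invSeq-≤ {n} w i = begin
  invSeq w i              ≡⟨ invSeq-count w i ⟩
  count (inversion? w i)  ≤⟨ count-mono (inversion? w i) (_<? i) (λ _ → proj₁) ⟩
  count {n} (_<? i)       ≡⟨ count-< i ⟩
  toℕ i                   ∎
  where open ℕP.≤-Reasoning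

invSeq-cong : (u v : Permutation′ n) (i : Fin n) →
              (∀ j → Inversion u i j ⇔ Inversion v i j) → invSeq u i ≡ invSeq v i
invSeq-cong u v i agree = begin
  invSeq u i             ≡⟨ invSeq-count u i ⟩
  count (inversion? u i) ≡⟨ count-cong (inversion? u i) (inversion? v i) agree ⟩
  count (inversion? v i) ≡⟨ invSeq-count v i ⟨
  invSeq v i             ∎
  where open ≡-Reasoning

-- A permutation is determined by its inversion sequence

-- Below i, u and v order the values alike; the values each of them places after i form a
-- final segment of that common order, and final segments of equal size coincide.
inversions-⊆ : (u v : Permutation′ n) (i : Fin n) → invSeq u i ≡ invSeq v i →
               (∀ {k} → k < i → Inversion u k ≐′ Inversion v k) → Inversion u i ⊆′ Inversion v i
inversions-⊆ u v i eq below =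
  count-≡⇒⊆ (inversion? u i) (inversion? v i)
    (trans (sym (invSeq-count u i)) (trans eq (invSeq-count v i))) crossing
  where
  crossing : ∀ {j j′} → Inversion u i j → ¬ Inversion v i j →
                        Inversion v i j′ → ¬ Inversion u i j′ → ⊥
  crossing {j} {j′} (j<i , u:i<j) ¬v:ij (j′<i , v:i<j′) ¬u:ij′ =
    clash (FinP.<-trans (noninversion u j′<i ¬u:ij′) u:i<j)
          (FinP.<-trans (noninversion v j<i ¬v:ij) v:i<j′)
    where
    clash : Before u j′ j → Before v j j′ → ⊥
    clash u:j′<j v:j<j′ with FinP.<-cmp j j′
    ... | tri< j<j′ _ _ = FinP.<-asym (proj₂ (proj₁ (below j′<i) j (j<j′ , u:j′<j))) v:j<j′
    ... | tri≈ _ refl _ = FinP.<-irrefl refl u:j′<j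
    ... | tri> _ _ j′<j = FinP.<-asym (proj₂ (proj₂ (below j<i) j′ (j′<j , v:j<j′))) u:j′<j

inversions-≐ : (u v : Permutation′ n) → (∀ i → invSeq u i ≡ invSeq v i) →
               ∀ i → Inversion u i ≐′ Inversion v i
inversions-≐ u v same i = go (<-wellFounded i)
  where
  go : ∀ {i} → Acc _<_ i → Inversion u i ≐′ Inversion v i
  go {i} (acc below) = inversions-⊆ u v i (same i) (go ∘ below)
                     , inversions-⊆ v u i (sym (same i)) (swap ∘ go ∘ below)

Before-transfer : (u v : Permutation′ n) → (∀ i → Inversion u i ≐′ Inversion v i) →
                  Before u x y → Before v x y
Before-transfer {x = x} {y} u v inv u:x<y with FinP.<-cmp x y
... | tri< x<y _ _ with v ⟨$⟩ˡ x <? v ⟨$⟩ˡ y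
...   | yes v:x<y = v:x<y
...   | no  v:x≮y = contradiction u:x<y
        (FinP.<-asym (proj₂ (proj₂ (inv y) x (x<y , Before-total v (FinP.<⇒≢ x<y) v:x≮y))))
Before-transfer u v inv u:x<y | tri≈ _ refl _ = contradiction u:x<y (FinP.<-irrefl refl)
Before-transfer u v inv u:x<y | tri> _ _ y<x  = proj₂ (proj₁ (inv _) _ (y<x , u:x<y))

increasing⇒inflationary : (f : Fin n → Fin n) → (∀ {p q} → p < q → f p < f q) →
                          ∀ p → p ≤ f p
increasing⇒inflationary {zero}  f _ ()
increasing⇒inflationary {suc n} f increasing = <-weakInduction (λ p → p ≤ f p) z≤n step
  where
  step : ∀ i → inject₁ i ≤ f (inject₁ i) → suc i ≤ f (suc i)
  step i i≤fi = ℕP.≤-<-trans (subst (ℕ._≤ toℕ (f (inject₁ i))) (FinP.toℕ-inject₁ i) i≤fi)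
                             (increasing (FinP.≤̄⇒inject₁< FinP.≤-refl))

sameOrder⇒≈ₚ : (u v : Permutation′ n) → (∀ {x y} → Before u x y → Before v x y) →
               (∀ {x y} → Before v x y → Before u x y) → u ≈ₚ v
sameOrder⇒≈ₚ u v u⇒v v⇒u p = begin
  u ⟨$⟩ʳ p     ≡⟨ inverseʳ v ⟨
  v ⟨$⟩ʳ (f p) ≡⟨ cong (v ⟨$⟩ʳ_) (FinP.≤-antisym f-deflationary f-inflationary) ⟩
  v ⟨$⟩ʳ p     ∎
  where
  open ≡-Reasoning
  f g : Fin _ → Fin _
  f q = v ⟨$⟩ˡ (u ⟨$⟩ʳ q)
  g q = u ⟨$⟩ˡ (v ⟨$⟩ʳ q)
  increasing : (u v : Permutation′ _) → (∀ {x y} → Before u x y → Before v x y) →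
               ∀ {p q} → p < q → v ⟨$⟩ˡ (u ⟨$⟩ʳ p) < v ⟨$⟩ˡ (u ⟨$⟩ʳ q)
  increasing u v u⇒v p<q = u⇒v (subst₂ _<_ (sym (inverseˡ u)) (sym (inverseˡ u)) p<q)
  f-inflationary : p ≤ f p
  f-inflationary = increasing⇒inflationary f (increasing u v u⇒v) p
  f-deflationary : f p ≤ p
  f-deflationary = subst (f p ≤_) (trans (cong (u ⟨$⟩ˡ_) (inverseʳ v)) (inverseˡ u))
                         (increasing⇒inflationary g (increasing v u v⇒u) (f p))

invSeq-injective : (u v : Permutation′ n) → (∀ i → invSeq u i ≡ invSeq v i) → u ≈ₚ v
invSeq-injective u v same =
  sameOrder⇒≈ₚ u v (Before-transfer u v inv) (Before-transfer v u (swap ∘ inv))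
  where
  inv : ∀ i → Inversion u i ≐′ Inversion v i
  inv = inversions-≐ u v same

-- Swapping a mesh occurrence

MeshOccurrence : Permutation′ n → Fin n → Fin n → Set
MeshOccurrence v a b =
  a < b × v ⟨$⟩ʳ a < v ⟨$⟩ʳ b × (∀ c → a < c → c < b → ¬ (v ⟨$⟩ʳ c < v ⟨$⟩ʳ b))

MeshSwap : Permutation′ n → Permutation′ n → Set
MeshSwap v w = ∃[ a ] ∃[ b ] (a < b × v ⟨$⟩ʳ a < v ⟨$⟩ʳ b ×
  (∀ c → a < c → c < b → ¬ (v ⟨$⟩ʳ c < v ⟨$⟩ʳ b)) × SwapOf v w a b)

record IncrementAt (v w : Permutation′ n) (k : Fin n) : Set where
  constructor incrementAt
  field
    at        : invSeq w k ≡ suc (invSeq v k)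
    elsewhere : ∀ i → i ≢ k → invSeq v i ≡ invSeq w i

module MeshOccurrenceSwap {v w : Permutation′ n} {a b : Fin n}
                          (occurrence : MeshOccurrence v a b) (swapped : SwapOf v w a b) where

  A B : Fin n
  A = v ⟨$⟩ʳ a
  B = v ⟨$⟩ʳ b

  a<b : a < b
  a<b = proj₁ occurrence

  A<B : A < B
  A<B = proj₁ (proj₂ occurrence)

  v⁻¹A : v ⟨$⟩ˡ A ≡ a
  v⁻¹A = inverseˡ v

  v⁻¹B : v ⟨$⟩ˡ B ≡ b
  v⁻¹B = inverseˡ v

  w⁻¹A : w ⟨$⟩ˡ A ≡ b
  w⁻¹A = trans (cong (w ⟨$⟩ˡ_) (sym (proj₁ (proj₂ swapped)))) (inverseˡ w)

  w⁻¹B : w ⟨$⟩ˡ B ≡ a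
  w⁻¹B = trans (cong (w ⟨$⟩ˡ_) (sym (proj₁ swapped))) (inverseˡ w)

  w⁻¹-other : x ≢ A → x ≢ B → w ⟨$⟩ˡ x ≡ v ⟨$⟩ˡ x
  w⁻¹-other {x} x≢A x≢B = trans (cong (w ⟨$⟩ˡ_) (sym (trans w-p≡v-p (inverseʳ v)))) (inverseˡ w)
    where
    w-p≡v-p : w ⟨$⟩ʳ (v ⟨$⟩ˡ x) ≡ v ⟨$⟩ʳ (v ⟨$⟩ˡ x)
    w-p≡v-p = proj₂ (proj₂ swapped) (v ⟨$⟩ˡ x) (⟨$⟩ˡ-≢ v x≢A) (⟨$⟩ˡ-≢ v x≢B)

  beyond-gap : x < B → a < v ⟨$⟩ˡ x → b < v ⟨$⟩ˡ x
  beyond-gap {x} x<B a<p = ≢∧≮⇒> (λ p≡b → FinP.<-irrefl (cong (v ⟨$⟩ʳ_) p≡b) x′<B)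
                                 (λ p<b → proj₂ (proj₂ occurrence) _ a<p p<b x′<B)
    where
    x′<B : v ⟨$⟩ʳ (v ⟨$⟩ˡ x) < B
    x′<B = subst (_< B) (sym (inverseʳ v)) x<B

  below-gap : x < B → x ≢ A → v ⟨$⟩ˡ x < b → v ⟨$⟩ˡ x < a
  below-gap {x} x<B x≢A p<b with v ⟨$⟩ˡ x <? a
  ... | yes p<a = p<a
  ... | no  p≮a = contradiction p<b (FinP.<-asym (beyond-gap x<B (≢∧≮⇒> (⟨$⟩ˡ-≢ v x≢A) p≮a)))

  before-off : j ≢ A → j ≢ B → j < i → Before v i j ⇔ Before w i j
  before-off {j} {i} j≢A j≢B j<i with i ≟ A | i ≟ B
  ... | yes refl | _ rewrite v⁻¹A | w⁻¹A | w⁻¹-other j≢A j≢B =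
    mk⇔ (beyond-gap (FinP.<-trans j<i A<B)) (FinP.<-trans a<b)
  ... | no _ | yes refl rewrite v⁻¹B | w⁻¹B | w⁻¹-other j≢A j≢B =
    mk⇔ (FinP.<-trans a<b) (beyond-gap j<i)
  ... | no i≢A | no i≢B rewrite w⁻¹-other i≢A i≢B | w⁻¹-other j≢A j≢B = mk⇔ id id

  inversion-off : j ≢ A → j ≢ B → Inversion v i j ⇔ Inversion w i j
  inversion-off j≢A j≢B = inversion-cong v w (before-off j≢A j≢B)

  invSeq-below : i < B → invSeq v i ≡ invSeq w i
  invSeq-below {i} i<B = invSeq-cong v w i agree
    where
    before-A : A < i → Before v i A ⇔ Before w i A
    before-A A<i rewrite v⁻¹A | w⁻¹A | w⁻¹-other (FinP.<⇒≢ A<i ∘ sym) (FinP.<⇒≢ i<B) =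
      mk⇔ (λ p<a → FinP.<-trans p<a a<b) (below-gap i<B (FinP.<⇒≢ A<i ∘ sym))
    agree : ∀ j → Inversion v i j ⇔ Inversion w i j
    agree j with j ≟ A | j ≟ B
    ... | _        | yes refl = inversion-out-of-range v w (FinP.<-asym i<B)
    ... | yes refl | no _     = inversion-cong v w before-A
    ... | no j≢A   | no j≢B   = inversion-off j≢A j≢B

  invSeq-at : invSeq w B ≡ suc (invSeq v B)
  invSeq-at = begin
    invSeq w B                   ≡⟨ invSeq-count w B ⟩
    count (inversion? w B)       ≡⟨ count-insert (inversion? v B) (inversion? w B) A
                                      agree ¬inversion-v inversion-w ⟩
    suc (count (inversion? v B)) ≡⟨ cong suc (invSeq-count v B) ⟨
    suc (invSeq v B)             ∎
    where
    open ≡-Reasoning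
    agree : ∀ j → j ≢ A → Inversion v B j ⇔ Inversion w B j
    agree j j≢A with j ≟ B
    ... | yes refl = inversion-out-of-range v w (FinP.<-irrefl refl)
    ... | no j≢B   = inversion-off j≢A j≢B
    ¬inversion-v : ¬ Inversion v B A
    ¬inversion-v (_ , b<a) = FinP.<-asym a<b (subst₂ _<_ v⁻¹B v⁻¹A b<a)
    inversion-w : Inversion w B A
    inversion-w = A<B , subst₂ _<_ (sym w⁻¹B) (sym w⁻¹A) a<b

  invSeq-above : B < i → invSeq v i ≡ invSeq w i
  invSeq-above {i} B<i = begin
    invSeq v i             ≡⟨ invSeq-count v i ⟩
    count (inversion? v i) ≡⟨ count-swap (inversion? v i) (inversion? w i) (FinP.<⇒≢ A<B)
                                (λ _ → inversion-off) A⇔B B⇔A ⟩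
    count (inversion? w i) ≡⟨ invSeq-count w i ⟨
    invSeq w i             ∎
    where
    open ≡-Reasoning
    A<i : A < i
    A<i = FinP.<-trans A<B B<i
    i≢A : i ≢ A
    i≢A = FinP.<⇒≢ A<i ∘ sym
    i≢B : i ≢ B
    i≢B = FinP.<⇒≢ B<i ∘ sym
    A⇔B : Inversion v i A ⇔ Inversion w i B
    A⇔B rewrite v⁻¹A | w⁻¹B | w⁻¹-other i≢A i≢B = mk⇔ (λ (_ , p) → B<i , p) (λ (_ , p) → A<i , p)
    B⇔A : Inversion v i B ⇔ Inversion w i A
    B⇔A rewrite v⁻¹B | w⁻¹A | w⁻¹-other i≢A i≢B = mk⇔ (λ (_ , p) → A<i , p) (λ (_ , p) → B<i , p)

  increment : IncrementAt v w B
  increment = incrementAt invSeq-at off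
    where
    off : ∀ i → i ≢ B → invSeq v i ≡ invSeq w i
    off i i≢B with FinP.<-cmp i B
    ... | tri< i<B _ _ = invSeq-below i<B
    ... | tri≈ _ i≡B _ = contradiction i≡B i≢B
    ... | tri> _ _ B<i = invSeq-above B<i

≗-at∧elsewhere : {A : Set} {f g : Fin n → A} (k : Fin n) →
                 f k ≡ g k → (∀ i → i ≢ k → f i ≡ g i) → ∀ i → f i ≡ g i
≗-at∧elsewhere k at elsewhere i with i ≟ k
... | yes refl = at
... | no  i≢k  = elsewhere i i≢k

increment⇒≤ₘ : IncrementAt v w k → v ≤ₘ w
increment⇒≤ₘ {v = v} {k = k} (incrementAt at elsewhere) i with i ≟ k
... | yes refl = subst (invSeq v i ℕ.≤_) (sym at) (ℕP.n≤1+n _)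
... | no  i≢k  = ℕP.≤-reflexive (elsewhere i i≢k)

increment-least : IncrementAt v u k → v ≤ₘ w → invSeq v k ℕ.< invSeq w k → u ≤ₘ w
increment-least {k = k} {w = w} (incrementAt at elsewhere) v≤w v<w i with i ≟ k
... | yes refl = subst (ℕ._≤ invSeq w i) (sym at) v<w
... | no  i≢k  = subst (ℕ._≤ invSeq w i) (elsewhere i i≢k) (v≤w i)

increment-squeeze : IncrementAt v w k → v ≤ₘ u → u ≤ₘ w → u ≈ₚ v ⊎ u ≈ₚ w
increment-squeeze {v = v} {w} {k} {u} (incrementAt at elsewhere) v≤u u≤w =
  Sum.map (λ u<w → invSeq-injective u v (≗-at∧elsewhere k (at-v u<w) u≡v-elsewhere))
          (λ u≡w → invSeq-injective u w (≗-at∧elsewhere k u≡w u≡w-elsewhere))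
          (ℕP.m≤n⇒m<n∨m≡n (u≤w k))
  where
  u≡v-elsewhere : ∀ i → i ≢ k → invSeq u i ≡ invSeq v i
  u≡v-elsewhere i i≢k =
    ℕP.≤-antisym (subst (invSeq u i ℕ.≤_) (sym (elsewhere i i≢k)) (u≤w i)) (v≤u i)
  u≡w-elsewhere : ∀ i → i ≢ k → invSeq u i ≡ invSeq w i
  u≡w-elsewhere i i≢k = trans (u≡v-elsewhere i i≢k) (elsewhere i i≢k)
  at-v : invSeq u k ℕ.< invSeq w k → invSeq u k ≡ invSeq v k
  at-v u<w = ℕP.≤-antisym (ℕ.s≤s⁻¹ (subst (invSeq u k ℕ.<_) at u<w)) (v≤u k)

≈ₚ-sym : u ≈ₚ v → v ≈ₚ u
≈ₚ-sym u≈v = sym ∘ u≈v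

swap-≉ₚ : (v w : Permutation′ n) → a ≢ b → SwapOf v w a b → ¬ v ≈ₚ w
swap-≉ₚ {a = a} v w a≢b (wa≡vb , _) v≈w = a≢b (⟨$⟩ʳ-injective v (trans (v≈w a) wa≡vb))

meshSwap⇒covers : (v w : Permutation′ n) → MeshSwap v w → Covers v w
meshSwap⇒covers v w (a , b , a<b , A<B , gap , swapped) =
  (increment⇒≤ₘ increment , swap-≉ₚ v w (FinP.<⇒≢ a<b) swapped) , nothing-between
  where
  increment : IncrementAt v w (v ⟨$⟩ʳ b)
  increment = MeshOccurrenceSwap.increment (a<b , A<B , gap) swapped
  nothing-between : ¬ (∃[ u ] (v <ₘ u × u <ₘ w))
  nothing-between (u , (v≤u , v≉u) , (u≤w , u≉w)) =
    Sum.[ v≉u ∘ ≈ₚ-sym {u = u} {v} , u≉w ] (increment-squeeze {u = u} increment v≤u u≤w)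

<ₘ⇒<-somewhere : (v w : Permutation′ n) → v <ₘ w → ∃[ k ] invSeq v k ℕ.< invSeq w k
<ₘ⇒<-somewhere {n} v w (v≤w , v≉w) =
  let (k , v≢w) = FinP.¬∀⟶∃¬ n (λ i → invSeq v i ≡ invSeq w i) (λ i → invSeq v i ℕ.≟ invSeq w i)
                               (v≉w ∘ invSeq-injective v w)
  in k , ℕP.≤∧≢⇒< (v≤w k) v≢w

smaller-value-before : (v : Permutation′ n) → invSeq v k ℕ.< toℕ k →
                       ∃[ j ] (j < k × Before v j k)
smaller-value-before {n} {k} v x<k with FinP.any? (λ j → (j <? k) ×-dec (v ⟨$⟩ˡ j <? v ⟨$⟩ˡ k))
... | yes found = found
... | no  none  =
  contradiction (trans (invSeq-count v k) (trans all-inversions (count-< k))) (ℕP.<⇒≢ x<k)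
  where
  all-inversions : count (inversion? v k) ≡ count {n} (_<? k)
  all-inversions = count-cong (inversion? v k) (_<? k) λ j →
    mk⇔ proj₁ (λ j<k → j<k , Before-total v (FinP.<⇒≢ j<k) (λ before → none (j , j<k , before)))

mesh-occurrence : (v : Permutation′ n) → a < b → v ⟨$⟩ʳ a < v ⟨$⟩ʳ b →
                  ∃[ a′ ] MeshOccurrence v a′ b
mesh-occurrence {b = b} v = nearest (>-wellFounded _)
  where
  nearest : ∀ {a} → Acc _>_ a → a < b → v ⟨$⟩ʳ a < v ⟨$⟩ʳ b → ∃[ a′ ] MeshOccurrence v a′ b
  nearest {a} (acc closer) a<b va<vb
    with FinP.any? (λ c → (a <? c) ×-dec ((c <? b) ×-dec (v ⟨$⟩ʳ c <? v ⟨$⟩ʳ b)))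
  ... | yes (c , a<c , c<b , vc<vb) = nearest (closer a<c) c<b vc<vb
  ... | no  none = a , a<b , va<vb , λ c a<c c<b vc<vb → none (c , a<c , c<b , vc<vb)

mesh-occurrence-ending-at : (v : Permutation′ n) → invSeq v k ℕ.< toℕ k →
                            ∃[ a ] MeshOccurrence v a (v ⟨$⟩ˡ k)
mesh-occurrence-ending-at v x<k =
  let (j , j<k , j-before-k) = smaller-value-before v x<k
  in mesh-occurrence v j-before-k (subst₂ _<_ (sym (inverseʳ v)) (sym (inverseʳ v)) j<k)

transpose-swapOf : (v : Permutation′ n) (a b : Fin n) → SwapOf v (transpose a b ∘ₚ v) a b
transpose-swapOf v a b =
  cong (v ⟨$⟩ʳ_) at-a , cong (v ⟨$⟩ʳ_) at-b , λ c c≢a c≢b → cong (v ⟨$⟩ʳ_) (elsewhere c c≢a c≢b)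
  where
  at-a : Components.transpose a b a ≡ b
  at-a with a ≟ a
  ... | yes _   = refl
  ... | no  a≢a = contradiction refl a≢a
  at-b : Components.transpose a b b ≡ a
  at-b with b ≟ a
  ... | yes b≡a = b≡a
  ... | no  _ with b ≟ b
  ...   | yes _   = refl
  ...   | no  b≢b = contradiction refl b≢b
  elsewhere : ∀ c → c ≢ a → c ≢ b → Components.transpose a b c ≡ c
  elsewhere c c≢a c≢b with c ≟ a
  ... | yes c≡a = contradiction c≡a c≢a
  ... | no  _ with c ≟ b
  ...   | yes c≡b = contradiction c≡b c≢b
  ...   | no  _   = refl

swapOf-resp-≈ₚ : SwapOf v u a b → u ≈ₚ w → SwapOf v w a b
swapOf-resp-≈ₚ {a = a} {b} (ua , ub , elsewhere) u≈w =
  trans (sym (u≈w a)) ua , trans (sym (u≈w b)) ub ,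
  λ c c≢a c≢b → trans (sym (u≈w c)) (elsewhere c c≢a c≢b)

covers⇒swapOf : (v w : Permutation′ n) → Covers v w → MeshOccurrence v a b →
                invSeq v (v ⟨$⟩ʳ b) ℕ.< invSeq w (v ⟨$⟩ʳ b) → SwapOf v w a b
covers⇒swapOf {a = a} {b} v w ((v≤w , _) , nothing-between) occurrence@(a<b , _) v<w =
  swapOf-resp-≈ₚ {v = v} {v′} {w = w} swapped v′≈w
  where
  v′ : Permutation′ _
  v′ = transpose a b ∘ₚ v
  swapped : SwapOf v v′ a b
  swapped = transpose-swapOf v a b
  increment : IncrementAt v v′ (v ⟨$⟩ʳ b)
  increment = MeshOccurrenceSwap.increment occurrence swapped
  v<v′ : v <ₘ v′
  v<v′ = increment⇒≤ₘ increment , swap-≉ₚ v v′ (FinP.<⇒≢ a<b) swapped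
  v′≈w : v′ ≈ₚ w
  v′≈w = decidable-stable (FinP.all? λ p → v′ ⟨$⟩ʳ p ≟ w ⟨$⟩ʳ p) λ v′≉w →
    nothing-between (v′ , v<v′ , increment-least {w = w} increment v≤w v<w , v′≉w)

covers⇒meshSwap : (v w : Permutation′ n) → Covers v w → MeshSwap v w
covers⇒meshSwap v w covers =
  let (k , v<w) = <ₘ⇒<-somewhere v w (proj₁ covers)
      (a , occurrence@(a<b , A<B , gap)) =
        mesh-occurrence-ending-at v (ℕP.<-≤-trans v<w (invSeq-≤ w k))
  in a , v ⟨$⟩ˡ k , a<b , A<B , gap , covers⇒swapOf v w covers occurrence
       (subst (λ i → invSeq v i ℕ.< invSeq w i) (sym (inverseʳ v)) v<w)

theorem1p9 : (n : ℕ) (v w : Permutation′ n) →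
    Covers v w ⇔
      (∃[ a ] ∃[ b ] (a < b × (v ⟨$⟩ʳ a) < (v ⟨$⟩ʳ b) ×
        (∀ c → a < c → c < b → ¬ ((v ⟨$⟩ʳ c) < (v ⟨$⟩ʳ b))) ×
        SwapOf v w a b))
theorem1p9 n v w = mk⇔ (covers⇒meshSwap v w) (meshSwap⇒covers v w)
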